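{- For every $n\ge 1$, let $G$ be the digraph with $n$ vertices whose arrows are exactly one loop at each vertex. Then there is no Leibniz algebra $A$ (of dimension $n$ over $\mathbb{F}$) with a basis such that its action to the right digraph $G_R(A)$ is $G$; likewise there is none whose action to the left digraph $G_L(A)$ is $G$.
   Context: $\mathbb{F}$ is an algebraically closed field of characteristic zero. A Leibniz algebra is an $\mathbb{F}$-vector space with bilinear product $[-,-]$ satisfying $[[x,y],z]-[[x,z],y]-[x,[y,z]]=0$ for all $x,y,z$. For a basis $\{x_1,\dots,x_n\}$ write $[x_i,x_j]=\sum_l c_{ij}^l x_l$. $G_R(A)$ has vertices $x_1,\dots,x_n$ and an arrow $x_i\to x_l$ iff $c_{ij}^l\neq0$ for some $j$; $G_L(A)$ has vertices $x_1,\dots,x_n$ and an arrow $x_j\to x_l$ iff $c_{ij}^l\ne0$ for some $i$ (loops allowed). -}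

module Defs where

open import Level using (Level; _⊔_; Lift)
open import Data.Nat using (ℕ; zero; suc)
import Data.Fin as Fin
open Fin using (Fin)
open import Data.Empty using (⊥)
open import Data.Sum using (_⊎_)
open import Relation.Binary.PropositionalEquality using (_≡_)
open import Data.List using (List; []; _∷_)
open import Data.Product using (Σ; ∃; _×_; _,_)
open import Relation.Nullary using (¬_)
open import Algebra.Bundles using (CommutativeRing)

record Field (c ℓ : Level) : Set (Level.suc (c ⊔ ℓ)) where
  field
    commutativeRing : CommutativeRing c ℓ
  open CommutativeRing commutativeRing public
  field
    1≉0     : ¬ (1# ≈ 0#)
    inverse : ∀ x → ¬ (x ≈ 0#) → Σ Carrier λ y → x * y ≈ 1#

module FieldNotions {c ℓ : Level} (F : Field c ℓ) where
  open Field F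

  natF : ℕ → Carrier
  natF zero    = 0#
  natF (suc n) = 1# + natF n

  CharacteristicZero : Set ℓ
  CharacteristicZero = ∀ n → ¬ (natF (suc n) ≈ 0#)

  -- polynomials as coefficient lists a₀ ∷ a₁ ∷ … (lowest degree first)
  Poly : Set c
  Poly = List Carrier

  eval : Poly → Carrier → Carrier
  eval []       x = 0#
  eval (a ∷ p)  x = a + x * eval p x

  NonConstant : Poly → Set ℓ
  NonConstant []      = Lift ℓ ⊥
  NonConstant (a ∷ p) = SomeNonzero p
    where
    SomeNonzero : Poly → Set ℓ
    SomeNonzero []      = Lift ℓ ⊥
    SomeNonzero (b ∷ q) = ¬ (b ≈ 0#) ⊎ SomeNonzero q

  AlgebraicallyClosed : Set (c ⊔ ℓ)
  AlgebraicallyClosed = ∀ p → NonConstant p → Σ Carrier λ r → eval p r ≈ 0#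

  sumF : ∀ n → (Fin n → Carrier) → Carrier
  sumF zero    f = 0#
  sumF (suc n) f = f Fin.zero + sumF n (λ i → f (Fin.suc i))

  -- Structure constants: SC n assigns c i j l = c_{ij}^l, [x_i,x_j] = Σ_l c_{ij}^l x_l.
  SC : ℕ → Set c
  SC n = Fin n → Fin n → Fin n → Carrier

  -- The n-dimensional algebra F^n (coordinate vectors w.r.t. the basis x_1..x_n)
  -- with the bilinear product determined by the structure constants.
  Vect : ℕ → Set c
  Vect n = Fin n → Carrier

  bracket : ∀ {n} → SC n → Vect n → Vect n → Vect n
  bracket {n} C u v l = sumF n λ i → sumF n λ j → u i * v j * C i j l

  _≈V_ : ∀ {n} → Vect n → Vect n → Set ℓ
  u ≈V v = ∀ l → u l ≈ v l

  IsLeibniz : ∀ {n} → SC n → Set (c ⊔ ℓ)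
  IsLeibniz {n} C = ∀ (x y z : Vect n) →
    (λ l → bracket C (bracket C x y) z l - bracket C (bracket C x z) y l
                                         - bracket C x (bracket C y z) l)
    ≈V (λ _ → 0#)

  Digraph : ℕ → Set (Level.suc ℓ)
  Digraph n = Fin n → Fin n → Set ℓ

  GR : ∀ {n} → SC n → Digraph n
  GR {n} C i l = ∃ λ j → ¬ (C i j l ≈ 0#)

  GL : ∀ {n} → SC n → Digraph n
  GL {n} C j l = ∃ λ i → ¬ (C i j l ≈ 0#)

  _≅G_ : ∀ {n} → Digraph n → Digraph n → Set ℓ
  G ≅G H = ∀ a b → (G a b → H a b) × (H a b → G a b)

loopsOnly : ∀ {ℓ} n → Fin n → Fin n → Set ℓ
loopsOnly {ℓ} n a b = Lift ℓ (a ≡ b)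

-- If G_R(A) has only loops, every product [x_i, x_j] is a multiple c_{ij} x_i.
-- Choose j with c_{ij} ≠ 0 (the loop at x_i) and k with c_{jk} ≠ 0 (the loop
-- at x_j); the Leibniz identity for x_i, x_j, x_k reduces to c_{jk} c_{ij} x_i = 0.
-- If G_L(A) has only loops, [x_i, x_j] = d_{ij} x_j. The Leibniz identity for
-- x_t, x_t, x_t gives d_{tt}² = 0, and for x_i, x_i, x_j with i ≠ j it gives
-- d_{ii} d_{ij} = d_{ij}², so d_{ij} = d_{ii} whenever d_{ij} ≠ 0. Hence every
-- d_{ij} vanishes, contradicting the loop at any vertex.
module Submission where

open import Defs
open import Level using (Level; lift; lower)
open import Data.Nat using (ℕ; suc; _≥_)
open import Data.Fin using (Fin; zero; suc; _≟_)
open import Data.Fin.Properties using (suc-injective; sequence)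
open import Data.Product using (_×_; Σ; ∃; _,_; proj₁; proj₂)
open import Function using (flip; _∘_)
open import Effect.Monad using (RawMonad)
open import Relation.Nullary using (¬_; Dec; yes; no; contradiction)
open import Relation.Nullary.Negation using (¬¬-Monad; ¬¬-map)
open import Relation.Nullary.Decidable using (¬¬-excluded-middle)
open import Relation.Binary.PropositionalEquality using (_≡_; _≢_)
import Relation.Binary.PropositionalEquality as ≡

module _ {c ℓ : Level} (F : Field c ℓ) where
  open Field F hiding (zero)
  open FieldNotions F
  open import Relation.Binary.Reasoning.Setoid setoid
  open import Algebra.Properties.Group +-group
    using (x≈y⇒x∙y⁻¹≈ε; x∙y⁻¹≈ε⇒x≈y; ε⁻¹≈ε; ⁻¹-involutive)

  *-cancelʳ-≉0 : ∀ {x y z} → ¬ z ≈ 0# → x * z ≈ y * z → x ≈ y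
  *-cancelʳ-≉0 {x} {y} {z} z≉0 xz≈yz with inverse z z≉0
  ... | z⁻¹ , zz⁻¹≈1 = begin
    x             ≈⟨ *-identityʳ x ⟨
    x * 1#        ≈⟨ *-congˡ zz⁻¹≈1 ⟨
    x * (z * z⁻¹) ≈⟨ *-assoc x z z⁻¹ ⟨
    x * z * z⁻¹   ≈⟨ *-congʳ xz≈yz ⟩
    y * z * z⁻¹   ≈⟨ *-assoc y z z⁻¹ ⟩
    y * (z * z⁻¹) ≈⟨ *-congˡ zz⁻¹≈1 ⟩
    y * 1#        ≈⟨ *-identityʳ y ⟩
    y             ∎

  y≉0⇒x*y≈0⇒x≈0 : ∀ {x y} → ¬ y ≈ 0# → x * y ≈ 0# → x ≈ 0#
  y≉0⇒x*y≈0⇒x≈0 {y = y} y≉0 xy≈0 = *-cancelʳ-≉0 y≉0 (trans xy≈0 (sym (zeroˡ y)))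

  x≈y⇒x-y-z≈0⇒z≈0 : ∀ {x y z} → x ≈ y → x - y - z ≈ 0# → z ≈ 0#
  x≈y⇒x-y-z≈0⇒z≈0 {x} {y} {z} x≈y x-y-z≈0 = begin
    z       ≈⟨ ⁻¹-involutive z ⟨
    - (- z) ≈⟨ -‿cong -z≈0 ⟩
    - 0#    ≈⟨ ε⁻¹≈ε ⟩
    0#      ∎
    where
    -z≈0 : - z ≈ 0#
    -z≈0 = begin
      - z           ≈⟨ +-identityˡ (- z) ⟨
      0# - z        ≈⟨ +-congʳ (x≈y⇒x∙y⁻¹≈ε x≈y) ⟨
      x - y - z     ≈⟨ x-y-z≈0 ⟩
      0#            ∎

  y≈0⇒x-y-z≈0⇒x≈z : ∀ {x y z} → y ≈ 0# → x - y - z ≈ 0# → x ≈ z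
  y≈0⇒x-y-z≈0⇒x≈z {x} {y} {z} y≈0 x-y-z≈0 = x∙y⁻¹≈ε⇒x≈y x z (begin
    x - z         ≈⟨ +-congʳ x-y≈x ⟨
    x - y - z     ≈⟨ x-y-z≈0 ⟩
    0#            ∎)
    where
    x-y≈x : x - y ≈ x
    x-y≈x = begin
      x - y   ≈⟨ +-congˡ (-‿cong y≈0) ⟩
      x - 0#  ≈⟨ +-congˡ ε⁻¹≈ε ⟩
      x + 0#  ≈⟨ +-identityʳ x ⟩
      x       ∎

  Supported : ∀ {n} → Vect n → Fin n → Set ℓ
  Supported u i = ∀ a → a ≢ i → u a ≈ 0#

  sumF-≈0 : ∀ n {f : Vect n} → (∀ a → f a ≈ 0#) → sumF n f ≈ 0#
  sumF-≈0 0       f≈0 = refl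
  sumF-≈0 (suc n) f≈0 =
    trans (+-cong (f≈0 zero) (sumF-≈0 n (λ a → f≈0 (suc a)))) (+-identityˡ 0#)

  sumF-supported : ∀ n {f : Vect n} i → Supported f i → sumF n f ≈ f i
  sumF-supported (suc n) zero f-supp =
    trans (+-congˡ (sumF-≈0 n (λ a → f-supp (suc a) λ ()))) (+-identityʳ _)
  sumF-supported (suc n) (suc i) f-supp =
    trans (+-congʳ (f-supp zero λ ()))
          (trans (+-identityˡ _)
                 (sumF-supported n i (λ a a≢i → f-supp (suc a) (a≢i ∘ suc-injective))))

  basis : ∀ {n} → Fin n → Vect n
  basis i a with a ≟ i
  ... | yes _ = 1#
  ... | no  _ = 0#

  basis-supported : ∀ {n} (i : Fin n) → Supported (basis i) i
  basis-supported i a a≢i with a ≟ i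
  ... | yes a≡i = contradiction a≡i a≢i
  ... | no  _   = refl

  basis-diagonal : ∀ {n} (i : Fin n) → basis i i ≈ 1#
  basis-diagonal i with i ≟ i
  ... | yes _   = refl
  ... | no  i≢i = contradiction ≡.refl i≢i

  module _ {n} (C : SC n) where

    bracket-supported : ∀ {u v i j} → Supported u i → Supported v j →
                        ∀ l → bracket C u v l ≈ u i * v j * C i j l
    bracket-supported {u} {v} {i} {j} u-supp v-supp l =
      trans (sumF-supported n i (λ a a≢i → sumF-≈0 n (λ b →
               trans (*-congʳ (*-congʳ (u-supp a a≢i)))
                     (trans (*-congʳ (zeroˡ (v b))) (zeroˡ (C a b l))))))
            (sumF-supported n j (λ b b≢j →
               trans (*-congʳ (trans (*-congˡ (v-supp b b≢j)) (zeroʳ (u i))))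
                     (zeroˡ (C i b l))))

    bracket-basisʳ : ∀ {u i} → Supported u i →
                     ∀ k l → bracket C u (basis k) l ≈ u i * C i k l
    bracket-basisʳ {u} {i} u-supp k l =
      trans (bracket-supported u-supp (basis-supported k) l)
            (*-congʳ (trans (*-congˡ (basis-diagonal k)) (*-identityʳ (u i))))

    bracket-basisˡ : ∀ {v j} → Supported v j →
                     ∀ i l → bracket C (basis i) v l ≈ v j * C i j l
    bracket-basisˡ {v} {j} v-supp i l =
      trans (bracket-supported (basis-supported i) v-supp l)
            (*-congʳ (trans (*-congʳ (basis-diagonal i)) (*-identityˡ (v j))))

    bracket-basis : ∀ i j l → bracket C (basis i) (basis j) l ≈ C i j l
    bracket-basis i j l =
      trans (bracket-basisˡ (basis-supported j) i l)
            (trans (*-congʳ (basis-diagonal j)) (*-identityˡ (C i j l)))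

    leibniz-basis : IsLeibniz C → ∀ i j k l {p q r} →
      bracket C (bracket C (basis i) (basis j)) (basis k) l ≈ p →
      bracket C (bracket C (basis i) (basis k)) (basis j) l ≈ q →
      bracket C (basis i) (bracket C (basis j) (basis k)) l ≈ r →
      p - q - r ≈ 0#
    leibniz-basis leibniz i j k l [[ij]k]≈p [[ik]j]≈q [i[jk]]≈r =
      trans (+-cong (+-cong (sym [[ij]k]≈p) (-‿cong (sym [[ik]j]≈q))) (-‿cong (sym [i[jk]]≈r)))
            (leibniz (basis i) (basis j) (basis k) l)

    -- [x_i, x_j] ∈ F x_{σ i j}; G_R with only loops forces σ i j = i, G_L forces σ i j = j.
    module Monomial (σ : Fin n → Fin n → Fin n)
                    (monomial : ∀ i j → Supported (C i j) (σ i j)) where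

      bracket-basis-supported : ∀ i j → Supported (bracket C (basis i) (basis j)) (σ i j)
      bracket-basis-supported i j a a≢σij = trans (bracket-basis i j a) (monomial i j a a≢σij)

      bracket-nestedˡ : ∀ i j k l →
        bracket C (bracket C (basis i) (basis j)) (basis k) l ≈ C i j (σ i j) * C (σ i j) k l
      bracket-nestedˡ i j k l =
        trans (bracket-basisʳ (bracket-basis-supported i j) k l)
              (*-congʳ (bracket-basis i j (σ i j)))

      bracket-nestedʳ : ∀ i j k l →
        bracket C (basis i) (bracket C (basis j) (basis k)) l ≈ C j k (σ j k) * C i (σ j k) l
      bracket-nestedʳ i j k l =
        trans (bracket-basisˡ (bracket-basis-supported j k) i l)
              (*-congʳ (bracket-basis j k (σ j k)))

  -- Equality is not decidable in F, so "every nonzero entry lies on a loop"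
  -- only yields the support condition under double negation.
  loopsOnly⇒¬¬supported : ∀ {n} (M : Fin n → Fin n → Vect n) →
    (∀ s t → (∃ λ k → ¬ M s k t ≈ 0#) → s ≡ t) →
    ¬ ¬ (∀ s k → Supported (M s k) s)
  loopsOnly⇒¬¬supported M arrow⇒loop =
    all λ s → all λ k → all λ t → ¬¬-map (entry s k t) ¬¬-excluded-middle
    where
    all = sequence (RawMonad.rawApplicative ¬¬-Monad)
    entry : ∀ s k t → Dec (M s k t ≈ 0#) → t ≢ s → M s k t ≈ 0#
    entry s k t (yes M≈0) _   = M≈0
    entry s k t (no  M≉0) t≢s = contradiction (≡.sym (arrow⇒loop s t (k , M≉0))) t≢s

  module _ {n} (C : SC n) (leibniz : IsLeibniz C) where

    rightMonomial⇒Cjkj*Ciji≈0 : (∀ i j → Supported (C i j) i) →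
                                ∀ i j k → C j k j * C i j i ≈ 0#
    rightMonomial⇒Cjkj*Ciji≈0 monomial i j k = x≈y⇒x-y-z≈0⇒z≈0 (*-comm _ _)
      (leibniz-basis C leibniz i j k i
        (bracket-nestedˡ i j k i) (bracket-nestedˡ i k j i) (bracket-nestedʳ i j k i))
      where open Monomial C (λ i _ → i) monomial

    module _ (monomial : ∀ i j → Supported (C i j) j) where
      open Monomial C (λ _ j → j) monomial

      leftMonomial⇒Ciii²≈0 : ∀ i → C i i i * C i i i ≈ 0#
      leftMonomial⇒Ciii²≈0 i = x≈y⇒x-y-z≈0⇒z≈0 refl
        (leibniz-basis C leibniz i i i i
          (bracket-nestedˡ i i i i) (bracket-nestedˡ i i i i) (bracket-nestedʳ i i i i))

      leftMonomial⇒Ciii*Cijj≈Cijj² : ∀ i j → i ≢ j → C i i i * C i j j ≈ C i j j * C i j j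
      leftMonomial⇒Ciii*Cijj≈Cijj² i j i≢j = y≈0⇒x-y-z≈0⇒x≈z
        (trans (*-congˡ (monomial j i j (i≢j ∘ ≡.sym))) (zeroʳ _))
        (leibniz-basis C leibniz i i j j
          (bracket-nestedˡ i i j j) (bracket-nestedˡ i j i j) (bracket-nestedʳ i i j j))

      leftMonomial⇒¬¬Cijj≈0 : ∀ i j → ¬ ¬ C i j j ≈ 0#
      leftMonomial⇒¬¬Cijj≈0 i j Cijj≉0 with i ≟ j
      ... | yes ≡.refl = Cijj≉0 (y≉0⇒x*y≈0⇒x≈0 Cijj≉0 (leftMonomial⇒Ciii²≈0 i))
      ... | no  i≢j    = Cijj≉0 (y≉0⇒x*y≈0⇒x≈0 Cijj≉0 (begin
        C i j j * C i j j ≈⟨ *-cong Ciii≈Cijj Ciii≈Cijj ⟨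
        C i i i * C i i i ≈⟨ leftMonomial⇒Ciii²≈0 i ⟩
        0#                ∎))
        where
        Ciii≈Cijj : C i i i ≈ C i j j
        Ciii≈Cijj = *-cancelʳ-≉0 Cijj≉0
          (trans (leftMonomial⇒Ciii*Cijj≈Cijj² i j i≢j) (*-comm _ _))

  ¬GR≅loopsOnly : ∀ {n} → Fin n → (C : SC n) → IsLeibniz C →
                  ¬ (GR C ≅G loopsOnly n)
  ¬GR≅loopsOnly v C leibniz iso =
    loopsOnly⇒¬¬supported C (λ s t arrow → lower (proj₁ (iso s t) arrow)) λ monomial →
      Cjkj≉0 (y≉0⇒x*y≈0⇒x≈0 Cvjv≉0 (rightMonomial⇒Cjkj*Ciji≈0 C leibniz monomial v j k))
    where
    loop : ∀ i → GR C i i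
    loop i = proj₂ (iso i i) (lift ≡.refl)
    j = proj₁ (loop v)
    Cvjv≉0 = proj₂ (loop v)
    k = proj₁ (loop j)
    Cjkj≉0 = proj₂ (loop j)

  ¬GL≅loopsOnly : ∀ {n} → Fin n → (C : SC n) → IsLeibniz C →
                  ¬ (GL C ≅G loopsOnly n)
  ¬GL≅loopsOnly v C leibniz iso =
    loopsOnly⇒¬¬supported (flip C) (λ s t arrow → lower (proj₁ (iso s t) arrow)) λ supported →
      leftMonomial⇒¬¬Cijj≈0 C leibniz (λ i j → supported j i) i v Civv≉0
    where
    i = proj₁ (proj₂ (iso v v) (lift ≡.refl))
    Civv≉0 = proj₂ (proj₂ (iso v v) (lift ≡.refl))

proposition4p1 : ∀ {c ℓ : Level} (F : Field c ℓ) →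
    FieldNotions.AlgebraicallyClosed F → FieldNotions.CharacteristicZero F →
    ∀ (n : ℕ) → n ≥ 1 →
      ¬ (Σ (FieldNotions.SC F n) λ C → FieldNotions.IsLeibniz F C
           × FieldNotions._≅G_ F (FieldNotions.GR F C) (loopsOnly n))
      × ¬ (Σ (FieldNotions.SC F n) λ C → FieldNotions.IsLeibniz F C
           × FieldNotions._≅G_ F (FieldNotions.GL F C) (loopsOnly n))
proposition4p1 F _ _ (suc m) _ =
  (λ (C , leibniz , iso) → ¬GR≅loopsOnly F zero C leibniz iso) ,
  (λ (C , leibniz , iso) → ¬GL≅loopsOnly F zero C leibniz iso)
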